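{- Let $m\ge 1$ and let $\alpha_1\ge\alpha_2\ge\cdots\ge\alpha_m\ge 1$ and $0\le\beta_1<\beta_2<\cdots<\beta_m$ be integers such that $\alpha_{r+1}+\beta_{r+1}=\alpha_r+\beta_r+1$ for all $r=1,\dots,m-1$. Define $P(x)=\sum_{r=1}^m x^{\alpha_r}(1+x)^{\beta_r}$. Then the coefficient sequence of $P(x)$ is unimodal.
   Context: A sequence $c_0,\dots,c_N$ is unimodal if there is an index $j$ with $c_0\le c_1\le\cdots\le c_j\ge c_{j+1}\ge\cdots\ge c_N$. -}

module Defs where

open import Data.Nat using (ℕ; zero; suc; _+_; _*_; _<_; _≤_)
open import Data.List using (List; []; _∷_; map; replicate; _++_; length; foldr; upTo)
open import Data.Product using (Σ; _×_)

-- Polynomials with natural-number coefficients, as coefficient lists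
-- (constant term first).
Poly : Set
Poly = List ℕ

addP : Poly → Poly → Poly
addP []       q        = q
addP (a ∷ p)  []       = a ∷ p
addP (a ∷ p)  (b ∷ q)  = (a + b) ∷ addP p q

scaleP : ℕ → Poly → Poly
scaleP a p = map (a *_) p

mulP : Poly → Poly → Poly
mulP []       q = []
mulP (a ∷ p)  q = addP (scaleP a q) (0 ∷ mulP p q)

xPow : ℕ → Poly
xPow a = replicate a 0 ++ (1 ∷ [])

onePlusXPow : ℕ → Poly
onePlusXPow zero    = 1 ∷ []
onePlusXPow (suc b) = mulP (1 ∷ 1 ∷ []) (onePlusXPow b)

-- P(x) = Σ_{r < m} x^{α r} (1+x)^{β r}   (indices shifted to 0 … m-1)
P : ℕ → (ℕ → ℕ) → (ℕ → ℕ) → Poly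
P m α β = foldr (λ r acc → addP (mulP (xPow (α r)) (onePlusXPow (β r))) acc) [] (upTo m)

coeff : Poly → ℕ → ℕ
coeff []       _       = 0
coeff (a ∷ p)  zero    = a
coeff (a ∷ p)  (suc i) = coeff p i

Unimodal : List ℕ → Set
Unimodal c = Σ ℕ λ j → (j < length c)
  × ((i : ℕ) → i < j → coeff c i ≤ coeff c (suc i))
  × ((i : ℕ) → j ≤ i → suc i < length c → coeff c (suc i) ≤ coeff c i)

-- Put d r = α r ∸ α (r + 1). The hypothesis on α + β says β (r + 1) = β r + d r + 1, so
-- P = (1 + x) ^ β 0 · Q 0, where Q (m - 1) = x ^ α (m - 1) and
-- Q r = x ^ α r + (1 + x) ^ (d r + 1) · Q (r + 1) (the sequence horner below).
-- Call a coefficient sequence strictly unimodal if it rises strictly up to a peak and falls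
-- strictly after it, runs of zeros aside. Multiplication by 1 + x produces such a sequence
-- even from one that is only weakly monotone at the two steps next to a position n, and that
-- is all the damage adding x ^ n can do to a strictly unimodal sequence with positive n-th
-- coefficient. As (1 + x) ^ (d r + 1) · Q (r + 1) has a positive coefficient at
-- α r = α (r + 1) + d r, induction shows that every (1 + x) · Q r is strictly unimodal,
-- and hence that P is unimodal.

module Submission where

open import Defs
open import Data.Nat using (ℕ; zero; suc; _+_; _*_; _∸_; _<_; _≤_; z≤n; s≤s; z<s; _≟_; _≤?_)
open import Data.Nat.Properties
open import Data.List using ([]; _∷_; foldr; applyUpTo; length)
open import Data.Product using (∃; _×_; _,_; proj₂)
open import Data.Sum using (_⊎_; inj₁; inj₂)
open import Data.Empty using (⊥-elim)
open import Function using (_∘_)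
open import Relation.Nullary using (yes; no)
open import Relation.Binary.PropositionalEquality
open import Data.Nat.Tactic.RingSolver using (solve-∀)
open import Algebra.Properties.CommutativeSemigroup +-commutativeSemigroup using (interchange)

Seq : Set
Seq = ℕ → ℕ

mulX : Seq → Seq
mulX f zero    = 0
mulX f (suc k) = f k

mul1+x : Seq → Seq
mul1+x f k = f k + mulX f k

mul1+x^ : ℕ → Seq → Seq
mul1+x^ zero    f = f
mul1+x^ (suc g) f = mul1+x (mul1+x^ g f)

monomial : ℕ → Seq
monomial zero    zero    = 1
monomial zero    (suc k) = 0
monomial (suc a) k       = mulX (monomial a) k

infixl 6 _⊕_
_⊕_ : Seq → Seq → Seq
(f ⊕ h) k = f k + h k

mulX-cong : ∀ {f h} → f ≗ h → mulX f ≗ mulX h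
mulX-cong f≗h zero    = refl
mulX-cong f≗h (suc k) = f≗h k

mul1+x-cong : ∀ {f h} → f ≗ h → mul1+x f ≗ mul1+x h
mul1+x-cong f≗h k = cong₂ _+_ (f≗h k) (mulX-cong f≗h k)

mul1+x-mulX : ∀ f → mul1+x (mulX f) ≗ mulX (mul1+x f)
mul1+x-mulX f zero    = refl
mul1+x-mulX f (suc k) = refl

mul1+x^-mulX : ∀ g f → mul1+x^ g (mulX f) ≗ mulX (mul1+x^ g f)
mul1+x^-mulX zero    f k = refl
mul1+x^-mulX (suc g) f k =
  trans (mul1+x-cong (mul1+x^-mulX g f) k) (mul1+x-mulX (mul1+x^ g f) k)

mulX-⊕ : ∀ f h → mulX (f ⊕ h) ≗ mulX f ⊕ mulX h
mulX-⊕ f h zero    = refl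
mulX-⊕ f h (suc k) = refl

mul1+x-⊕ : ∀ f h → mul1+x (f ⊕ h) ≗ mul1+x f ⊕ mul1+x h
mul1+x-⊕ f h k =
  trans (cong (f k + h k +_) (mulX-⊕ f h k)) (interchange (f k) (h k) (mulX f k) (mulX h k))

mul1+x^-⊕ : ∀ g f h → mul1+x^ g (f ⊕ h) ≗ mul1+x^ g f ⊕ mul1+x^ g h
mul1+x^-⊕ zero    f h k = refl
mul1+x^-⊕ (suc g) f h k =
  trans (mul1+x-cong (mul1+x^-⊕ g f h) k) (mul1+x-⊕ (mul1+x^ g f) (mul1+x^ g h) k)

mul1+x^-+ : ∀ a b f → mul1+x^ (a + b) f ≡ mul1+x^ a (mul1+x^ b f)
mul1+x^-+ zero    b f = refl
mul1+x^-+ (suc a) b f = cong mul1+x (mul1+x^-+ a b f)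

mul1+x^-≥ : ∀ {j g} f k → j ≤ g → f k ≤ mul1+x^ g f (j + k)
mul1+x^-≥ {zero}  {zero}  f k _         = ≤-refl
mul1+x^-≥ {zero}  {suc g} f k _         = ≤-trans (mul1+x^-≥ {g = g} f k z≤n) (m≤m+n _ _)
mul1+x^-≥ {suc j} {suc g} f k (s≤s j≤g) = ≤-trans (mul1+x^-≥ f k j≤g) (m≤n+m _ _)

monomial-same : ∀ a → monomial a a ≡ 1
monomial-same zero    = refl
monomial-same (suc a) = monomial-same a

monomial-other : ∀ {a k} → k ≢ a → monomial a k ≡ 0
monomial-other {zero}  {zero}  k≢a = ⊥-elim (k≢a refl)
monomial-other {zero}  {suc k} k≢a = refl
monomial-other {suc a} {zero}  k≢a = refl
monomial-other {suc a} {suc k} k≢a = monomial-other (k≢a ∘ cong suc)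

coeff-addP : ∀ p q k → coeff (addP p q) k ≡ coeff p k + coeff q k
coeff-addP []      q       k       = refl
coeff-addP (a ∷ p) []      k       = sym (+-identityʳ _)
coeff-addP (a ∷ p) (b ∷ q) zero    = refl
coeff-addP (a ∷ p) (b ∷ q) (suc k) = coeff-addP p q k

coeff-scaleP : ∀ a q k → coeff (scaleP a q) k ≡ a * coeff q k
coeff-scaleP a []      k       = sym (*-zeroʳ a)
coeff-scaleP a (b ∷ q) zero    = refl
coeff-scaleP a (b ∷ q) (suc k) = coeff-scaleP a q k

coeff-0∷ : ∀ p → coeff (0 ∷ p) ≗ mulX (coeff p)
coeff-0∷ p zero    = refl
coeff-0∷ p (suc k) = refl

coeff-mulP-∷ : ∀ a p q k → coeff (mulP (a ∷ p) q) k ≡ a * coeff q k + mulX (coeff (mulP p q)) k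
coeff-mulP-∷ a p q k =
  trans (coeff-addP (scaleP a q) (0 ∷ mulP p q) k)
        (cong₂ _+_ (coeff-scaleP a q k) (coeff-0∷ (mulP p q) k))

mulX-coeff-[] : ∀ k → mulX (coeff []) k ≡ 0
mulX-coeff-[] zero    = refl
mulX-coeff-[] (suc k) = refl

coeff-mulP-1 : ∀ q → coeff (mulP (1 ∷ []) q) ≗ coeff q
coeff-mulP-1 q k = begin
  coeff (mulP (1 ∷ []) q) k              ≡⟨ coeff-mulP-∷ 1 [] q k ⟩
  1 * coeff q k + mulX (coeff []) k      ≡⟨ cong₂ _+_ (*-identityˡ _) (mulX-coeff-[] k) ⟩
  coeff q k + 0                          ≡⟨ +-identityʳ _ ⟩
  coeff q k                              ∎
  where open ≡-Reasoning

coeff-onePlusXPow : ∀ b → coeff (onePlusXPow b) ≗ mul1+x^ b (monomial 0)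
coeff-onePlusXPow zero    zero    = refl
coeff-onePlusXPow zero    (suc k) = refl
coeff-onePlusXPow (suc b) k       = begin
  coeff (mulP (1 ∷ 1 ∷ []) q) k                 ≡⟨ coeff-mulP-∷ 1 (1 ∷ []) q k ⟩
  1 * coeff q k + mulX (coeff (mulP (1 ∷ []) q)) k
    ≡⟨ cong₂ _+_ (*-identityˡ _) (mulX-cong (coeff-mulP-1 q) k) ⟩
  mul1+x (coeff q) k                            ≡⟨ mul1+x-cong (coeff-onePlusXPow b) k ⟩
  mul1+x^ (suc b) (monomial 0) k                ∎
  where
  open ≡-Reasoning
  q = onePlusXPow b

coeff-term : ∀ a b → coeff (mulP (xPow a) (onePlusXPow b)) ≗ mul1+x^ b (monomial a)
coeff-term zero    b k = trans (coeff-mulP-1 (onePlusXPow b) k) (coeff-onePlusXPow b k)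
coeff-term (suc a) b k =
  trans (coeff-mulP-∷ 0 (xPow a) (onePlusXPow b) k)
        (trans (mulX-cong (coeff-term a b) k) (sym (mul1+x^-mulX b (monomial a) k)))

summand : (ℕ → ℕ) → (ℕ → ℕ) → ℕ → Poly
summand α β r = mulP (xPow (α r)) (onePlusXPow (β r))

foldr-applyUpTo : ∀ n h α β →
  foldr (λ r → addP (summand α β r)) [] (applyUpTo h n) ≡ P n (α ∘ h) (β ∘ h)
foldr-applyUpTo zero    h α β = refl
foldr-applyUpTo (suc n) h α β = cong (addP (summand α β (h 0)))
  (trans (foldr-applyUpTo n (h ∘ suc) α β) (sym (foldr-applyUpTo n suc (α ∘ h) (β ∘ h))))

P-suc : ∀ n α β → P (suc n) α β ≡ addP (summand α β 0) (P n (α ∘ suc) (β ∘ suc))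
P-suc n α β = cong (addP (summand α β 0)) (foldr-applyUpTo n suc α β)

coeff-P-suc : ∀ n α β k →
  coeff (P (suc n) α β) k ≡ mul1+x^ (β 0) (monomial (α 0)) k + coeff (P n (α ∘ suc) (β ∘ suc)) k
coeff-P-suc n α β k = begin
  coeff (P (suc n) α β) k                          ≡⟨ cong (λ p → coeff p k) (P-suc n α β) ⟩
  coeff (addP (summand α β 0) rest) k              ≡⟨ coeff-addP (summand α β 0) rest k ⟩
  coeff (summand α β 0) k + coeff rest k
    ≡⟨ cong (_+ coeff rest k) (coeff-term (α 0) (β 0) k) ⟩
  mul1+x^ (β 0) (monomial (α 0)) k + coeff rest k  ∎
  where
  open ≡-Reasoning
  rest = P n (α ∘ suc) (β ∘ suc)

-- Lets the zeros outside the support count as strict steps.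
infix 4 _<₀_
_<₀_ : ℕ → ℕ → Set
x <₀ y = x < y ⊎ (x ≡ 0 × y ≡ 0)

z<₀n : ∀ n → 0 <₀ n
z<₀n zero    = inj₂ (refl , refl)
z<₀n (suc n) = inj₁ z<s

<₀⇒≤ : ∀ {x y} → x <₀ y → x ≤ y
<₀⇒≤ (inj₁ x<y)          = <⇒≤ x<y
<₀⇒≤ (inj₂ (refl , refl)) = ≤-refl

<₀⇒< : ∀ {x y} → 0 < x → x <₀ y → x < y
<₀⇒< 0<x (inj₁ x<y)         = x<y
<₀⇒< () (inj₂ (refl , refl))

m<₀n⇒m<₀o+n : ∀ {m n} o → m <₀ n → m <₀ o + n
m<₀n⇒m<₀o+n o (inj₁ m<n)          = inj₁ (m≤n⇒m≤o+n o m<n)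
m<₀n⇒m<₀o+n o (inj₂ (refl , refl)) = z<₀n (o + 0)

-- For consecutive coefficients x, y, z of c, a step of mul1+x c compares y + x with z + y;
-- it is strict as soon as both steps of c involved are monotone and one of them is strict.
≤-<₀-+ : ∀ {x y z} → x ≤ y → y <₀ z → y + x <₀ z + y
≤-<₀-+ x≤y (inj₁ y<z)          = inj₁ (+-mono-<-≤ y<z x≤y)
≤-<₀-+ z≤n (inj₂ (refl , refl)) = inj₂ (refl , refl)

<₀-≤-+ : ∀ {x y z} → x <₀ y → y ≤ z → y + x <₀ z + y
<₀-≤-+ (inj₁ x<y)          y≤z = inj₁ (+-mono-≤-< y≤z x<y)
<₀-≤-+ {z = z} (inj₂ (refl , refl)) _ = z<₀n (z + 0)

-- The step from p to p + 1 is unconstrained, so p or p + 1 is a peak.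
record StrictlyUnimodalAt (f : Seq) (p : ℕ) : Set where
  field
    rise : ∀ k → k < p → f k <₀ f (suc k)
    fall : ∀ k → p < k → f (suc k) <₀ f k

-- Adding x ^ n to a strictly unimodal sequence may flatten the steps out of and into n.
record AlmostStrictlyUnimodalAt (n : ℕ) (c : Seq) (p : ℕ) : Set where
  field
    rise-≤ : ∀ k → k < p → c k ≤ c (suc k)
    rise   : ∀ k → k < p → k ≢ n → c k <₀ c (suc k)
    fall-≤ : ∀ k → p < k → c (suc k) ≤ c k
    fall   : ∀ k → p < k → suc k ≢ n → c (suc k) <₀ c k

strict⇒almost : ∀ {f p} n → StrictlyUnimodalAt f p → AlmostStrictlyUnimodalAt n f p
strict⇒almost n s = record
  { rise-≤ = λ k k<p → <₀⇒≤ (rise k k<p)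
  ; rise   = λ k k<p _ → rise k k<p
  ; fall-≤ = λ k p<k → <₀⇒≤ (fall k p<k)
  ; fall   = λ k p<k _ → fall k p<k
  }
  where open StrictlyUnimodalAt s

monomial-strict : ∀ a → StrictlyUnimodalAt (monomial a) a
monomial-strict a = record { rise = rise ; fall = fall }
  where
  rise : ∀ k → k < a → monomial a k <₀ monomial a (suc k)
  rise k k<a rewrite monomial-other (<⇒≢ k<a) = z<₀n _
  fall : ∀ k → a < k → monomial a (suc k) <₀ monomial a k
  fall k a<k rewrite monomial-other (>⇒≢ a<k) | monomial-other (>⇒≢ (m<n⇒m<1+n a<k)) =
    inj₂ (refl , refl)

monomial-⊕-strict : ∀ {f p n} → StrictlyUnimodalAt f p → 0 < f n →
                    AlmostStrictlyUnimodalAt n (monomial n ⊕ f) p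
monomial-⊕-strict {f} {p} {n} s 0<f[n] = record
  { rise-≤ = rise-≤ ; rise = rise′ ; fall-≤ = fall-≤ ; fall = fall′ }
  where
  open StrictlyUnimodalAt s
  c = monomial n ⊕ f
  rise-≤ : ∀ k → k < p → c k ≤ c (suc k)
  rise-≤ k k<p with k ≟ n
  ... | yes refl rewrite monomial-same k = ≤-trans (<₀⇒< 0<f[n] (rise k k<p)) (m≤n+m _ _)
  ... | no  k≢n  rewrite monomial-other k≢n = ≤-trans (<₀⇒≤ (rise k k<p)) (m≤n+m _ _)
  rise′ : ∀ k → k < p → k ≢ n → c k <₀ c (suc k)
  rise′ k k<p k≢n rewrite monomial-other k≢n = m<₀n⇒m<₀o+n _ (rise k k<p)
  fall-≤ : ∀ k → p < k → c (suc k) ≤ c k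
  fall-≤ k p<k with suc k ≟ n
  ... | yes refl rewrite monomial-same (suc k) = ≤-trans (<₀⇒< 0<f[n] (fall k p<k)) (m≤n+m _ _)
  ... | no  1+k≢n rewrite monomial-other 1+k≢n = ≤-trans (<₀⇒≤ (fall k p<k)) (m≤n+m _ _)
  fall′ : ∀ k → p < k → suc k ≢ n → c (suc k) <₀ c k
  fall′ k p<k 1+k≢n rewrite monomial-other 1+k≢n = m<₀n⇒m<₀o+n _ (fall k p<k)

mul1+x-fall-≤-<₀ : ∀ c k → c (2 + k) ≤ c (suc k) → c (suc k) <₀ c k →
                   mul1+x c (2 + k) <₀ mul1+x c (suc k)
mul1+x-fall-≤-<₀ c k c[2+k]≤c[1+k] c[1+k]<₀c[k] =
  subst₂ _<₀_ (+-comm (c (suc k)) (c (2 + k))) (+-comm (c k) (c (suc k)))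
         (≤-<₀-+ c[2+k]≤c[1+k] c[1+k]<₀c[k])

mul1+x-fall-<₀-≤ : ∀ c k → c (2 + k) <₀ c (suc k) → c (suc k) ≤ c k →
                   mul1+x c (2 + k) <₀ mul1+x c (suc k)
mul1+x-fall-<₀-≤ c k c[2+k]<₀c[1+k] c[1+k]≤c[k] =
  subst₂ _<₀_ (+-comm (c (suc k)) (c (2 + k))) (+-comm (c k) (c (suc k)))
         (<₀-≤-+ c[2+k]<₀c[1+k] c[1+k]≤c[k])

module A = AlmostStrictlyUnimodalAt

module _ {n c p} (a : AlmostStrictlyUnimodalAt n c p) where
  open A a

  mul1+x-rise : ∀ k → k < p → mul1+x c k <₀ mul1+x c (suc k)
  mul1+x-rise zero    0<p = <₀-≤-+ (z<₀n (c 0)) (rise-≤ 0 0<p)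
  mul1+x-rise (suc k) 1+k<p with k ≟ n
  ... | no  k≢n  = <₀-≤-+ (rise k (<⇒≤ 1+k<p) k≢n) (rise-≤ (suc k) 1+k<p)
  ... | yes refl = ≤-<₀-+ (rise-≤ k (<⇒≤ 1+k<p)) (rise (suc k) 1+k<p 1+n≢n)

  mul1+x-fall : ∀ k → suc p < k → mul1+x c (suc k) <₀ mul1+x c k
  mul1+x-fall (suc k) (s≤s p<k) with suc k ≟ n
  ... | no  1+k≢n = mul1+x-fall-≤-<₀ c k (fall-≤ (suc k) (m<n⇒m<1+n p<k)) (fall k p<k 1+k≢n)
  ... | yes refl  = mul1+x-fall-<₀-≤ c k (fall (suc k) (m<n⇒m<1+n p<k) 1+n≢n) (fall-≤ k p<k)

  mul1+x-peak-rises : mul1+x c p <₀ mul1+x c (suc p) → StrictlyUnimodalAt (mul1+x c) (suc p)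
  mul1+x-peak-rises rises-at-p = record { rise = rise′ ; fall = mul1+x-fall }
    where
    rise′ : ∀ k → k < suc p → mul1+x c k <₀ mul1+x c (suc k)
    rise′ k (s≤s k≤p) with m≤n⇒m<n∨m≡n k≤p
    ... | inj₁ k<p  = mul1+x-rise k k<p
    ... | inj₂ refl = rises-at-p

  mul1+x-peak-falls : mul1+x c (2 + p) <₀ mul1+x c (suc p) → StrictlyUnimodalAt (mul1+x c) p
  mul1+x-peak-falls falls-at-1+p = record { rise = mul1+x-rise ; fall = fall′ }
    where
    fall′ : ∀ k → p < k → mul1+x c (suc k) <₀ mul1+x c k
    fall′ k p<k with m≤n⇒m<n∨m≡n p<k
    ... | inj₁ 1+p<k = mul1+x-fall k 1+p<k
    ... | inj₂ refl  = falls-at-1+p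

-- If the steps into and out of suc p are both flat (possible only for n = p), mul1+x c
-- already falls after suc p.
mul1+x-peak : ∀ {n c} p → AlmostStrictlyUnimodalAt n c p →
              mul1+x c p <₀ mul1+x c (suc p) ⊎ mul1+x c (2 + p) <₀ mul1+x c (suc p)
mul1+x-peak {c = c} p a with c p ≤? c (suc p)
... | no c[p]≰c[1+p] =
  inj₂ (mul1+x-fall-≤-<₀ c p (A.fall-≤ a (suc p) (n<1+n p)) (inj₁ (≰⇒> c[p]≰c[1+p])))
mul1+x-peak zero a | yes c[0]≤c[1] = inj₁ (<₀-≤-+ (z<₀n _) c[0]≤c[1])
mul1+x-peak {n} {c} (suc p) a | yes c[1+p]≤c[2+p] with p ≟ n | m≤n⇒m<n∨m≡n c[1+p]≤c[2+p]
... | no  p≢n  | _ = inj₁ (<₀-≤-+ (A.rise a p (n<1+n p) p≢n) c[1+p]≤c[2+p])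
... | yes refl | inj₁ c[1+p]<c[2+p] = inj₁ (≤-<₀-+ (A.rise-≤ a p (n<1+n p)) (inj₁ c[1+p]<c[2+p]))
... | yes refl | inj₂ c[1+p]≡c[2+p] =
  inj₂ (mul1+x-fall-<₀-≤ c (suc p) (A.fall a (2 + p) (n<1+n (suc p)) (>⇒≢ (m<n+m p z<s)))
                                  (≤-reflexive (sym c[1+p]≡c[2+p])))

mul1+x-strict : ∀ {n c p} → AlmostStrictlyUnimodalAt n c p → ∃ (StrictlyUnimodalAt (mul1+x c))
mul1+x-strict {p = p} a with mul1+x-peak p a
... | inj₁ rises = suc p , mul1+x-peak-rises a rises
... | inj₂ falls = p , mul1+x-peak-falls a falls

mul1+x^-strict : ∀ {n c p} g → AlmostStrictlyUnimodalAt n c p →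
                 ∃ (StrictlyUnimodalAt (mul1+x^ (suc g) c))
mul1+x^-strict zero    a = mul1+x-strict a
mul1+x^-strict (suc g) a with mul1+x^-strict g a
... | _ , s = mul1+x-strict (strict⇒almost 0 s)

UnimodalAt : Seq → ℕ → Set
UnimodalAt f j = (∀ i → i < j → f i ≤ f (suc i)) × (∀ i → j ≤ i → f (suc i) ≤ f i)

almost⇒unimodal : ∀ {n c p} → AlmostStrictlyUnimodalAt n c p → ∃ (UnimodalAt c)
almost⇒unimodal {c = c} {p} a with c p ≤? c (suc p)
... | yes c[p]≤c[1+p] = suc p , rise , A.fall-≤ a
  where
  rise : ∀ i → i < suc p → c i ≤ c (suc i)
  rise i (s≤s i≤p) with m≤n⇒m<n∨m≡n i≤p
  ... | inj₁ i<p  = A.rise-≤ a i i<p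
  ... | inj₂ refl = c[p]≤c[1+p]
... | no c[p]≰c[1+p] = p , A.rise-≤ a , fall
  where
  fall : ∀ i → p ≤ i → c (suc i) ≤ c i
  fall i p≤i with m≤n⇒m<n∨m≡n p≤i
  ... | inj₁ p<i  = A.fall-≤ a i p<i
  ... | inj₂ refl = <⇒≤ (≰⇒> c[p]≰c[1+p])

mul1+x^-unimodal : ∀ {n c p} g → AlmostStrictlyUnimodalAt n c p → ∃ (UnimodalAt (mul1+x^ g c))
mul1+x^-unimodal zero    a = almost⇒unimodal a
mul1+x^-unimodal (suc g) a = almost⇒unimodal (strict⇒almost 0 (proj₂ (mul1+x^-strict g a)))

unimodal-max : ∀ {f j} → UnimodalAt f j → ∀ i → f i ≤ f j
unimodal-max {f} {j} (rise , fall) i with ≤-total i j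
... | inj₁ i≤j = rising j i≤j ≤-refl
  where
  rising : ∀ k → i ≤ k → k ≤ j → f i ≤ f k
  rising zero    z≤n _ = ≤-refl
  rising (suc k) i≤1+k 1+k≤j with m≤n⇒m<n∨m≡n i≤1+k
  ... | inj₁ (s≤s i≤k) = ≤-trans (rising k i≤k (<⇒≤ 1+k≤j)) (rise k 1+k≤j)
  ... | inj₂ refl      = ≤-refl
... | inj₂ j≤i = falling i j≤i
  where
  falling : ∀ k → j ≤ k → f k ≤ f j
  falling zero    z≤n = ≤-refl
  falling (suc k) j≤1+k with m≤n⇒m<n∨m≡n j≤1+k
  ... | inj₁ (s≤s j≤k) = ≤-trans (fall k j≤k) (falling k j≤k)
  ... | inj₂ refl      = ≤-refl

coeff-pos⇒<length : ∀ c j → 0 < coeff c j → j < length c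
coeff-pos⇒<length (a ∷ c) zero    _        = z<s
coeff-pos⇒<length (a ∷ c) (suc j) 0<c[1+j] = s≤s (coeff-pos⇒<length c j 0<c[1+j])

unimodal-coeff : ∀ c {f j w} → coeff c ≗ f → UnimodalAt f j → 0 < f w → Unimodal c
unimodal-coeff c {f} {j} {w} c≗f (rise , fall) 0<f[w] = j , j<length , rise′ , fall′
  where
  j<length : j < length c
  j<length = coeff-pos⇒<length c j
    (subst (0 <_) (sym (c≗f j)) (<-≤-trans 0<f[w] (unimodal-max (rise , fall) w)))
  rise′ : ∀ i → i < j → coeff c i ≤ coeff c (suc i)
  rise′ i i<j = subst₂ _≤_ (sym (c≗f i)) (sym (c≗f (suc i))) (rise i i<j)
  fall′ : ∀ i → j ≤ i → suc i < length c → coeff c (suc i) ≤ coeff c i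
  fall′ i j≤i _ = subst₂ _≤_ (sym (c≗f (suc i))) (sym (c≗f i)) (fall i j≤i)

horner : ℕ → (ℕ → ℕ) → Seq
horner zero    α = monomial (α 0)
horner (suc n) α = monomial (α 0) ⊕ mul1+x^ (suc (α 0 ∸ α 1)) (horner n (α ∘ suc))

Descending : ℕ → (ℕ → ℕ) → Set
Descending m α = ∀ r → suc r < m → α (suc r) ≤ α r

horner-pos : ∀ n α → 0 < horner n α (α 0)
horner-pos zero    α rewrite monomial-same (α 0) = z<s
horner-pos (suc n) α rewrite monomial-same (α 0) = z<s

horner-almostStrict : ∀ n α → Descending (suc n) α →
                      ∃ (AlmostStrictlyUnimodalAt (α 0) (horner n α))
horner-almostStrict zero    α _ = α 0 , strict⇒almost (α 0) (monomial-strict (α 0))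
horner-almostStrict (suc n) α descending
  with horner-almostStrict n (α ∘ suc) (λ r 2+r<2+n → descending (suc r) (s≤s 2+r<2+n))
... | _ , a with mul1+x^-strict (α 0 ∸ α 1) a
... | q , s = q , monomial-⊕-strict s (<-≤-trans (horner-pos n (α ∘ suc)) tail≤)
  where
  tail = horner n (α ∘ suc)
  d = α 0 ∸ α 1
  tail≤ : tail (α 1) ≤ mul1+x^ (suc d) tail (α 0)
  tail≤ = subst (λ i → tail (α 1) ≤ mul1+x^ (suc d) tail i)
                (m∸n+n≡m (descending 0 (s≤s (s≤s z≤n))))
                (mul1+x^-≥ tail (α 1) (n≤1+n d))

exponent-step : ∀ {a₀ a₁ b₀ b₁} → a₁ ≤ a₀ → a₁ + b₁ ≡ a₀ + b₀ + 1 → b₁ ≡ b₀ + suc (a₀ ∸ a₁)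
exponent-step {a₀} {a₁} {b₀} {b₁} a₁≤a₀ eq = +-cancelˡ-≡ a₁ b₁ (b₀ + suc d) (begin
  a₁ + b₁              ≡⟨ eq ⟩
  a₀ + b₀ + 1          ≡⟨ cong (λ a → a + b₀ + 1) (sym (m+[n∸m]≡n a₁≤a₀)) ⟩
  a₁ + d + b₀ + 1      ≡⟨ shuffle a₁ d b₀ ⟩
  a₁ + (b₀ + suc d)    ∎)
  where
  open ≡-Reasoning
  d = a₀ ∸ a₁
  shuffle : ∀ a d b → a + d + b + 1 ≡ a + (b + suc d)
  shuffle = solve-∀

coeff-P : ∀ n α β → Descending (suc n) α →
          ((r : ℕ) → suc r < suc n → α (suc r) + β (suc r) ≡ α r + β r + 1) →
          coeff (P (suc n) α β) ≗ mul1+x^ (β 0) (horner n α)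
coeff-P zero    α β _ _ k = trans (coeff-P-suc 0 α β k) (+-identityʳ _)
coeff-P (suc n) α β descending linked k = begin
  coeff (P (2 + n) α β) k
    ≡⟨ coeff-P-suc (suc n) α β k ⟩
  head k + coeff (P (suc n) (α ∘ suc) (β ∘ suc)) k
    ≡⟨ cong (head k +_) (coeff-P n (α ∘ suc) (β ∘ suc)
                           (λ r 2+r<2+n → descending (suc r) (s≤s 2+r<2+n))
                           (λ r 2+r<2+n → linked (suc r) (s≤s 2+r<2+n)) k) ⟩
  head k + mul1+x^ (β 1) tail k
    ≡⟨ cong (λ b → head k + mul1+x^ b tail k)
            (exponent-step (descending 0 1<2+n) (linked 0 1<2+n)) ⟩
  head k + mul1+x^ (β 0 + suc (α 0 ∸ α 1)) tail k
    ≡⟨ cong (λ h → head k + h k) (mul1+x^-+ (β 0) (suc (α 0 ∸ α 1)) tail) ⟩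
  head k + mul1+x^ (β 0) (mul1+x^ (suc (α 0 ∸ α 1)) tail) k
    ≡⟨ sym (mul1+x^-⊕ (β 0) (monomial (α 0)) (mul1+x^ (suc (α 0 ∸ α 1)) tail) k) ⟩
  mul1+x^ (β 0) (horner (suc n) α) k ∎
  where
  open ≡-Reasoning
  head = mul1+x^ (β 0) (monomial (α 0))
  tail = horner n (α ∘ suc)
  1<2+n : 1 < 2 + n
  1<2+n = s≤s (s≤s z≤n)

lemma16 : (m : ℕ) (α β : ℕ → ℕ) → 1 ≤ m
    → ((r : ℕ) → suc r < m → α (suc r) ≤ α r)
    → 1 ≤ α (m ∸ 1)
    → ((r : ℕ) → suc r < m → β r < β (suc r))
    → ((r : ℕ) → suc r < m → α (suc r) + β (suc r) ≡ α r + β r + 1)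
    → Unimodal (P m α β)
lemma16 (suc n) α β _ descending _ _ linked with horner-almostStrict n α descending
... | _ , almostStrict with mul1+x^-unimodal (β 0) almostStrict
... | _ , unimodal = unimodal-coeff (P (suc n) α β) (coeff-P n α β descending linked) unimodal
                       (<-≤-trans (horner-pos n α) (mul1+x^-≥ (horner n α) (α 0) (z≤n {β 0})))
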